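{- Let $(\mathcal{R},W)$ be a Strip Packing instance, run the Bottom-Left algorithm with the $\mathcal{FQW}$-ordering $r_1,\dots,r_n$, let $a=|\mathcal{F}|$, and assume $\mathcal{Q}\neq\emptyset$ and $\max\{y_r+h_r:r\in\mathcal{Q}\}>h_{\max}$. Let $r_B$ be the leftmost bottom supporter of $r_{a+1}$. Then $h_r\le h_{r_B}$ for every $r\in\mathcal{Q}$.
   Context: Strip Packing: an instance $(\mathcal{R},W)$ consists of a strip $[0,W]\times[0,\infty)$ with $W>0$ and a finite set $\mathcal{R}$ of $n$ axis-parallel closed rectangles; rectangle $r$ has width $w_r\in(0,W]$ and height $h_r>0$; $h_{\max}=\max_r h_r$. A packing assigns to each $r$ a lower-left corner $(x_r,y_r)$; it is feasible if $x_r\ge0$, $x_r+w_r\le W$, $y_r\ge0$ and the open rectangles $(x_r,x_r+w_r)\times(y_r,y_r+h_r)$ are pairwise disjoint; no rotations. Bottom-Left (BL) algorithm: given an ordering $r_1,\dots,r_n$, place $r_1$ at $(0,0)$; for $i\ge2$ choose $(x_{r_i},y_{r_i})$ such that $r_1,\dots,r_i$ form a feasible packing and $(y_{r_i},x_{r_i})$ is lexicographically minimal. A bottom supporter of $r_i$ (with $y_{r_i}>0$) is a rectangle $r_j$ with $j<i$ whose top face touches the bottom face of $r_i$, i.e. $y_{r_j}+h_{r_j}=y_{r_i}$ and the $x$-intervals $(x_{r_j},x_{r_j}+w_{r_j})$ and $(x_{r_i},x_{r_i}+w_{r_i})$ intersect. $\mathcal{FQW}$-partition: go through the rectangles in order of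 non-increasing height (ties arbitrary), adding $r$ to $\mathcal{F}$ (initially empty) iff $w_r+\sum_{f\in\mathcal{F}}w_f\le W$; $\mathcal{W}=\{r\in\mathcal{R}\setminus\mathcal{F}:w_r>W/2\}$, $\mathcal{Q}=\mathcal{R}\setminus(\mathcal{F}\cup\mathcal{W})$. The $\mathcal{FQW}$-ordering lists $\mathcal{F}$ by non-increasing height, then $\mathcal{Q}$ by non-increasing width, then $\mathcal{W}$ in any order; ties arbitrary. Thus with $a=|\mathcal{F}|$, $r_{a+1}$ is the first rectangle of $\mathcal{Q}$ placed.
   Formalization: The strip width $W$, the widths and heights of the rectangles, and all positions, including the competing placements in the Bottom-Left minimality, are rational. -}

module Defs where

open import Data.Nat using (ℕ; zero; suc)
import Data.Nat as ℕ
open import Data.Fin using (Fin; toℕ) renaming (_<_ to _<ᶠ_; _≤_ to _≤ᶠ_)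
open import Data.Fin.Permutation using (Permutation′; _⟨$⟩ʳ_; _⟨$⟩ˡ_)
open import Data.Vec using (Vec; []; _∷_; lookup; tabulate; foldr)
open import Data.Bool using (Bool; true; false; if_then_else_)
open import Data.Rational using (ℚ; 0ℚ; ½; _+_; _*_; _≤_; _<_; _⊔_)
open import Data.Rational.Properties using (_≤?_; _<?_)
open import Relation.Nullary using (yes; no; ¬_)
open import Relation.Binary.PropositionalEquality using (_≡_)
open import Data.Product using (_×_; Σ; ∃)
open import Data.Sum using (_⊎_)

record Instance (n : ℕ) : Set where
  field
    W     : ℚ
    w h   : Fin n → ℚ
    W-pos : 0ℚ < W
    w-pos : ∀ i → 0ℚ < w i
    w-≤W  : ∀ i → w i ≤ W
    h-pos : ∀ i → 0ℚ < h i
open Instance public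

hmax : ∀ {n} → Instance n → ℚ
hmax {n} I = foldr (λ _ → ℚ) _⊔_ 0ℚ (tabulate (h I))

-- FQW partition.
-- π lists the rectangles in order of non-increasing height
-- (π ⟨$⟩ʳ k is the k-th rectangle of that list; ties arbitrary).
HeightOrder : ∀ {n} → Instance n → Permutation′ n → Set
HeightOrder I π = ∀ k l → k ≤ᶠ l → h I (π ⟨$⟩ʳ l) ≤ h I (π ⟨$⟩ʳ k)

greedy : ∀ {m} → ℚ → Vec ℚ m → ℚ → Vec Bool m
greedy W [] acc = []
greedy W (x ∷ xs) acc with x + acc ≤? W
... | yes _ = true  ∷ greedy W xs (x + acc)
... | no  _ = false ∷ greedy W xs acc

-- membership bits of F, in height order
Fbits : ∀ {n} → Instance n → Permutation′ n → Vec Bool n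
Fbits I π = greedy (W I) (tabulate (λ k → w I (π ⟨$⟩ʳ k))) 0ℚ

InF : ∀ {n} → Instance n → Permutation′ n → Fin n → Set
InF I π i = lookup (Fbits I π) (π ⟨$⟩ˡ i) ≡ true

InW : ∀ {n} → Instance n → Permutation′ n → Fin n → Set
InW I π i = ¬ InF I π i × (½ * W I < w I i)

InQ : ∀ {n} → Instance n → Permutation′ n → Fin n → Set
InQ I π i = ¬ InF I π i × ¬ InW I π i

countTrue : ∀ {m} → Vec Bool m → ℕ
countTrue [] = 0
countTrue (true ∷ bs) = suc (countTrue bs)
countTrue (false ∷ bs) = countTrue bs

sizeF : ∀ {n} → Instance n → Permutation′ n → ℕ
sizeF I π = countTrue (Fbits I π)

-- The index order of Fin n (i.e. r_1,…,r_n) is an FQW-ordering w.r.t.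
-- the partition induced by π: F first by non-increasing height, then Q
-- by non-increasing width, then W (any order).
data Cls : Set where cF cQ cW : Cls

rank : Cls → ℕ
rank cF = 0
rank cQ = 1
rank cW = 2

HasClass : ∀ {n} → Instance n → Permutation′ n → Fin n → Cls → Set
HasClass I π i cF = InF I π i
HasClass I π i cQ = InQ I π i
HasClass I π i cW = InW I π i

IsFQWOrdering : ∀ {n} → Instance n → Permutation′ n → Set
IsFQWOrdering I π =
  ∀ i j → i <ᶠ j →
    (∀ c d → HasClass I π i c → HasClass I π j d → rank c ℕ.≤ rank d)
    × (InF I π i → InF I π j → h I j ≤ h I i)
    × (InQ I π i → InQ I π j → w I j ≤ w I i)

Disjoint : (x y w h x' y' w' h' : ℚ) → Set
Disjoint x y w h x' y' w' h' =
  (x + w ≤ x') ⊎ (x' + w' ≤ x) ⊎ (y + h ≤ y') ⊎ (y' + h' ≤ y)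

Fits : ∀ {n} → Instance n → (x y : Fin n → ℚ) → Fin n → ℚ → ℚ → Set
Fits I x y i px py =
  (0ℚ ≤ px) × (px + w I i ≤ W I) × (0ℚ ≤ py)
  × (∀ j → j <ᶠ i → Disjoint px py (w I i) (h I i) (x j) (y j) (w I j) (h I j))

LexLE : ℚ → ℚ → ℚ → ℚ → Set
LexLE y x y' x' = (y < y') ⊎ ((y ≡ y') × (x ≤ x'))

-- x,y is the result of BL on the ordering given by the indices of Fin n.
IsBL : ∀ {n} → Instance n → (x y : Fin n → ℚ) → Set
IsBL I x y = ∀ i →
  Fits I x y i (x i) (y i)
  × (∀ px py → Fits I x y i px py → LexLE (y i) (x i) py px)

BottomSupporter : ∀ {n} → Instance n → (x y : Fin n → ℚ) → Fin n → Fin n → Set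
BottomSupporter I x y i j =
  (0ℚ < y i) × (j <ᶠ i) × (y j + h I j ≡ y i)
  × (x j < x i + w I i) × (x i < x j + w I j)

LeftmostBottomSupporter : ∀ {n} → Instance n → (x y : Fin n → ℚ) → Fin n → Fin n → Set
LeftmostBottomSupporter I x y i j =
  BottomSupporter I x y i j × (∀ k → BottomSupporter I x y i k → x j ≤ x k)

{-# OPTIONS --safe #-}
module Submission where

-- BL puts the F-rectangles r₁ … r_a side by side on the floor, in order of non-increasing
-- height, so the bottom supporter r_B of r_{a+1} is one of them and h_B = y_{a+1}.  Suppose
-- some r ∈ Q had h_r > y_{a+1}.  The F-rectangles taller than y_{a+1} form a prefix of that
-- row, and r_{a+1} overlaps them vertically, so it lies to their right: their total width is
-- at most x_{a+1}.  The rectangles the greedy put into F before reaching r are at least as tall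
-- as r, hence among them, and w_r ≤ w_{a+1} because Q is sorted by width.  So those rectangles
-- together with r have width at most x_{a+1} + w_{a+1} ≤ W, and the greedy would have put r
-- into F.

open import Defs
open import Data.Nat as ℕ using (ℕ; zero; suc; z≤n; s≤s)
import Data.Nat.Properties as ℕP
open import Data.Fin using (Fin; zero; suc; toℕ; fromℕ<) renaming (_<_ to _<ᶠ_)
import Data.Fin.Properties as FinP
open import Data.Fin.Induction using (<-wellFounded; Acc; acc)
open import Data.Fin.Permutation using (Permutation′; _⟨$⟩ʳ_; _⟨$⟩ˡ_; inverseʳ; flip)
open import Data.Rational using (ℚ; 0ℚ; ½; _+_; _*_; _≤_; _<_; _≤?_; _<?_)
import Data.Rational.Properties as ℚP
open import Data.Bool as Bool using (Bool; true; false; if_then_else_)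
open import Data.Bool.Properties using (¬-not)
open import Data.Vec using (Vec; []; _∷_; lookup; tabulate)
import Data.Vec.Properties as VecP
open import Data.Product using (Σ; _×_; _,_; proj₁; proj₂)
open import Data.Sum using (_⊎_; inj₁; inj₂)
open import Data.Empty using (⊥-elim)
open import Function using (_∘_; _⇔_; mk⇔; Equivalence)
open import Relation.Nullary using (¬_; yes; no; does; contradiction; _×-dec_)
open import Relation.Unary using (Decidable)
open import Relation.Binary.PropositionalEquality
open import Algebra.Bundles using (CommutativeMonoid)
import Algebra.Properties.CommutativeMonoid.Sum as CommutativeMonoidSum
open import Algebra.Properties.CommutativeSemigroup
  (CommutativeMonoid.commutativeSemigroup ℚP.+-0-commutativeMonoid) using (xy∙z≈y∙xz)

module ℚΣ = CommutativeMonoidSum ℚP.+-0-commutativeMonoid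
module ℕΣ = CommutativeMonoidSum ℕP.+-0-commutativeMonoid

<⇒≱ : ∀ {p q} → p < q → ¬ (q ≤ p)
<⇒≱ p<q q≤p = ℚP.<-irrefl refl (ℚP.<-≤-trans p<q q≤p)

p<p+q : ∀ p {q} → 0ℚ < q → p < p + q
p<p+q p {q} q>0 = subst (_< p + q) (ℚP.+-identityʳ p) (ℚP.+-monoʳ-< p q>0)

sum-mono : ∀ {n} {f g : Fin n → ℚ} → (∀ k → f k ≤ g k) → ℚΣ.sum f ≤ ℚΣ.sum g
sum-mono {zero}  f≤g = ℚP.≤-refl
sum-mono {suc n} f≤g = ℚP.+-mono-≤ (f≤g zero) (sum-mono (f≤g ∘ suc))

sumOver : ∀ {n} {P : Fin n → Set} → Decidable P → (Fin n → ℚ) → ℚ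
sumOver P? f = ℚΣ.sum λ k → if does (P? k) then f k else 0ℚ

module _ {n} {P Q : Fin n → Set} (P? : Decidable P) (Q? : Decidable Q) where

  sumOver-mono : {f g : Fin n → ℚ} → (∀ k → 0ℚ ≤ g k) → (∀ k → f k ≤ g k) →
                 (∀ {k} → P k → Q k) → sumOver P? f ≤ sumOver Q? g
  sumOver-mono {f} {g} g≥0 f≤g P⊆Q = sum-mono pointwise
    where
    pointwise : ∀ k → (if does (P? k) then f k else 0ℚ) ≤ (if does (Q? k) then g k else 0ℚ)
    pointwise k with P? k | Q? k
    ... | yes _ | yes _ = f≤g k
    ... | yes p | no ¬q = contradiction (P⊆Q p) ¬q
    ... | no _  | yes _ = g≥0 k
    ... | no _  | no _  = ℚP.≤-refl

  sumOver-cong : {f g : Fin n → ℚ} → (∀ {k} → P k ⇔ Q k) → (∀ k → f k ≡ g k) →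
                 sumOver P? f ≡ sumOver Q? g
  sumOver-cong {f} {g} P⇔Q f≗g = ℚΣ.sum-cong-≗ pointwise
    where
    pointwise : ∀ k → (if does (P? k) then f k else 0ℚ) ≡ (if does (Q? k) then g k else 0ℚ)
    pointwise k with P? k | Q? k
    ... | yes _ | yes _ = f≗g k
    ... | yes p | no ¬q = contradiction (Equivalence.to P⇔Q p) ¬q
    ... | no ¬p | yes q = contradiction (Equivalence.from P⇔Q q) ¬p
    ... | no _  | no _  = refl

sumOver-permute : ∀ {n} {P : Fin n → Set} (P? : Decidable P) (f : Fin n → ℚ) (σ : Permutation′ n) →
                  sumOver P? f ≡ sumOver (P? ∘ (σ ⟨$⟩ʳ_)) (f ∘ (σ ⟨$⟩ʳ_))
sumOver-permute P? f σ = ℚΣ.∑-permute _ σ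

prefixSum : ∀ {n} → (Fin n → ℚ) → ℕ → ℚ
prefixSum f t = sumOver (λ k → toℕ k ℕ.<? t) f

prefixSum-zero : ∀ {n} (f : Fin n → ℚ) → prefixSum f 0 ≡ 0ℚ
prefixSum-zero {n} f = ℚΣ.sum-replicate-zero n

prefixSum-suc : ∀ {n} (f : Fin n → ℚ) k → prefixSum f (suc (toℕ k)) ≡ prefixSum f (toℕ k) + f k
prefixSum-suc {suc n} f zero = begin
  f zero + S 0       ≡⟨ ℚP.+-comm (f zero) (S 0) ⟩
  S 0 + f zero       ≡⟨ cong (_+ f zero) (ℚP.+-identityˡ (S 0)) ⟨
  0ℚ + S 0 + f zero  ∎
  where
  open ≡-Reasoning
  S = prefixSum (f ∘ suc)
prefixSum-suc {suc n} f (suc k) = begin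
  f zero + S (suc (toℕ k))         ≡⟨ cong (f zero +_) (prefixSum-suc (f ∘ suc) k) ⟩
  f zero + (S (toℕ k) + f (suc k)) ≡⟨ ℚP.+-assoc (f zero) (S (toℕ k)) (f (suc k)) ⟨
  f zero + S (toℕ k) + f (suc k)   ∎
  where
  open ≡-Reasoning
  S = prefixSum (f ∘ suc)

prefixSum-mono : ∀ {n} {f : Fin n → ℚ} → (∀ k → 0ℚ ≤ f k) →
                 ∀ {s t} → s ℕ.≤ t → prefixSum f s ≤ prefixSum f t
prefixSum-mono f≥0 {s} {t} s≤t =
  sumOver-mono (λ k → toℕ k ℕ.<? s) (λ k → toℕ k ℕ.<? t) f≥0 (λ _ → ℚP.≤-refl)
               (λ k<s → ℕP.<-≤-trans k<s s≤t)

prefixSum-nonneg : ∀ {n} {f : Fin n → ℚ} → (∀ k → 0ℚ ≤ f k) → ∀ t → 0ℚ ≤ prefixSum f t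
prefixSum-nonneg {f = f} f≥0 t =
  subst (_≤ prefixSum f t) (prefixSum-zero f) (prefixSum-mono f≥0 {0} {t} z≤n)

beyond-intervals : ∀ {s : ℕ → ℚ} {p} → s 0 ≤ p →
                   ∀ u → (∀ j → j ℕ.< u → p < s j ⊎ s (suc j) ≤ p) → s u ≤ p
beyond-intervals s₀≤p zero    _      = s₀≤p
beyond-intervals s₀≤p (suc u) avoids with avoids u ℕP.≤-refl
... | inj₁ p<sᵤ   = contradiction (beyond-intervals s₀≤p u (λ j → avoids j ∘ ℕP.m<n⇒m<1+n))
                                  (<⇒≱ p<sᵤ)
... | inj₂ sᵤ₊₁≤p = sᵤ₊₁≤p

count : ∀ {n} {P : Fin n → Set} → Decidable P → ℕ
count P? = ℕΣ.sum λ k → if does (P? k) then 1 else 0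

count-≤ : ∀ {n} {P : Fin n → Set} (P? : Decidable P) → count P? ℕ.≤ n
count-≤ {zero}  P? = z≤n
count-≤ {suc n} P? with P? zero
... | yes _ = s≤s (count-≤ (P? ∘ suc))
... | no _  = ℕP.m≤n⇒m≤1+n (count-≤ (P? ∘ suc))

count-empty : ∀ {n} {P : Fin n → Set} (P? : Decidable P) → (∀ k → ¬ P k) → count P? ≡ 0
count-empty {zero}  P? ∅ = refl
count-empty {suc n} P? ∅ with P? zero
... | yes p = contradiction p (∅ zero)
... | no _  = count-empty (P? ∘ suc) (∅ ∘ suc)

count-permute : ∀ {n} {P : Fin n → Set} (P? : Decidable P) (σ : Permutation′ n) →
                count P? ≡ count (P? ∘ (σ ⟨$⟩ʳ_))
count-permute P? σ = ℕΣ.∑-permute _ σ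

DownwardClosed : ∀ {n} → (Fin n → Set) → Set
DownwardClosed P = ∀ {j k} → toℕ j ℕ.< toℕ k → P k → P j

downwardClosed⇒prefix : ∀ {n} {P : Fin n → Set} → DownwardClosed P → (P? : Decidable P) →
                        ∀ k → P k ⇔ toℕ k ℕ.< count P?
downwardClosed⇒prefix {suc n} {P} closed P? k with P? zero
downwardClosed⇒prefix {suc n} {P} closed P? zero    | yes p₀ = mk⇔ (λ _ → s≤s z≤n) (λ _ → p₀)
downwardClosed⇒prefix {suc n} {P} closed P? (suc k) | yes _  = mk⇔ (s≤s ∘ to) (from ∘ ℕ.s≤s⁻¹)
  where open Equivalence (downwardClosed⇒prefix (closed ∘ s≤s) (P? ∘ suc) k)
... | no ¬p₀ = mk⇔ (λ pₖ → contradiction (P-zero k pₖ) ¬p₀)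
                   (λ k<0 → ⊥-elim (ℕP.n≮0 (subst (toℕ k ℕ.<_) none k<0)))
  where
  P-zero : ∀ k → P k → P zero
  P-zero zero    p = p
  P-zero (suc k) p = closed (s≤s z≤n) p
  none : count (P? ∘ suc) ≡ 0
  none = count-empty (P? ∘ suc) (λ k → ¬p₀ ∘ P-zero (suc k))

set? : ∀ {m} (bs : Vec Bool m) → Decidable (λ t → lookup bs t ≡ true)
set? bs t = lookup bs t Bool.≟ true

countTrue≡count : ∀ {m} (bs : Vec Bool m) → countTrue bs ≡ count (set? bs)
countTrue≡count []           = refl
countTrue≡count (true  ∷ bs) = cong suc (countTrue≡count bs)
countTrue≡count (false ∷ bs) = countTrue≡count bs

greedy-fits : ∀ {m} W (ws : Vec ℚ m) used → used ≤ W →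
              used + sumOver (set? (greedy W ws used)) (lookup ws) ≤ W
greedy-fits W []       used used≤W = subst (_≤ W) (sym (ℚP.+-identityʳ used)) used≤W
greedy-fits W (v ∷ ws) used used≤W with v + used ≤? W
... | yes fits = subst (_≤ W) (xy∙z≈y∙xz v used _) (greedy-fits W ws (v + used) fits)
... | no _     = subst (_≤ W) (cong (used +_) (sym (ℚP.+-identityˡ _))) (greedy-fits W ws used used≤W)

-- The order test comes first in the conjunction so that it cuts off the summand at p itself
-- definitionally.
greedy-rejects : ∀ {m} W (ws : Vec ℚ m) used p → lookup (greedy W ws used) p ≡ false →
  W < used + sumOver (λ t → (toℕ t ℕ.<? toℕ p) ×-dec set? (greedy W ws used) t) (lookup ws)
        + lookup ws p
greedy-rejects W (v ∷ ws) used p rejected with v + used ≤? W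
greedy-rejects W (v ∷ ws) used zero    () | yes _
greedy-rejects W (v ∷ ws) used (suc p) rejected | yes _ =
  subst (W <_) (cong (_+ lookup ws p) (xy∙z≈y∙xz v used _)) (greedy-rejects W ws (v + used) p rejected)
greedy-rejects {suc m} W (v ∷ ws) used zero _ | no overflow = subst (W <_) v+used≡ (ℚP.≰⇒> overflow)
  where
  v+used≡ : v + used ≡ used + ℚΣ.sum {suc m} (λ _ → 0ℚ) + v
  v+used≡ = begin
    v + used                              ≡⟨ ℚP.+-comm v used ⟩
    used + v                              ≡⟨ cong (_+ v) (ℚP.+-identityʳ used) ⟨
    used + 0ℚ + v                         ≡⟨ cong (λ z → used + z + v) (ℚΣ.sum-replicate-zero (suc m)) ⟨
    used + ℚΣ.sum {suc m} (λ _ → 0ℚ) + v  ∎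
    where open ≡-Reasoning
greedy-rejects W (v ∷ ws) used (suc p) rejected | no _ =
  subst (W <_) (cong (λ s → used + s + lookup ws p) (sym (ℚP.+-identityˡ _)))
        (greedy-rejects W ws used p rejected)

Disjoint⇒side-by-side : ∀ {x y w h x′ y′ w′ h′} → Disjoint x y w h x′ y′ w′ h′ →
                        y < y′ + h′ → y′ < y + h → (x + w ≤ x′) ⊎ (x′ + w′ ≤ x)
Disjoint⇒side-by-side (inj₁ left)                _    _    = inj₁ left
Disjoint⇒side-by-side (inj₂ (inj₁ right))        _    _    = inj₂ right
Disjoint⇒side-by-side (inj₂ (inj₂ (inj₁ below))) _    over = contradiction below (<⇒≱ over)
Disjoint⇒side-by-side (inj₂ (inj₂ (inj₂ above))) over _    = contradiction above (<⇒≱ over)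

w-nonneg : ∀ {n} (I : Instance n) k → 0ℚ ≤ w I k
w-nonneg I k = ℚP.<⇒≤ (w-pos I k)

module FQWPartition {n} (I : Instance n) (π : Permutation′ n) where

  InF? : Decidable (InF I π)
  InF? k = set? (Fbits I π) (π ⟨$⟩ˡ k)

  F-width : {P : ℚ → Set} → Decidable P → ℚ
  F-width P? = sumOver (λ k → InF? k ×-dec P? (h I k)) (w I)

  F-width-mono : {P Q : ℚ → Set} (P? : Decidable P) (Q? : Decidable Q) → (∀ {t} → P t → Q t) →
                 F-width P? ≤ F-width Q?
  F-width-mono P? Q? P⊆Q =
    sumOver-mono (λ k → InF? k ×-dec P? (h I k)) (λ k → InF? k ×-dec Q? (h I k))
                 (w-nonneg I) (λ _ → ℚP.≤-refl) λ (k∈F , p) → k∈F , P⊆Q p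

  classify : ∀ k → Σ Cls (HasClass I π k)
  classify k with InF? k | ½ * W I <? w I k
  ... | yes k∈F | _         = cF , k∈F
  ... | no  k∉F | yes wide  = cW , (k∉F , wide)
  ... | no  k∉F | no  ¬wide = cQ , (k∉F , ¬wide ∘ proj₂)

  widthsByHeight : Vec ℚ n
  widthsByHeight = tabulate (λ t → w I (π ⟨$⟩ʳ t))

  lookup-widthsByHeight : ∀ k → lookup widthsByHeight (π ⟨$⟩ˡ k) ≡ w I k
  lookup-widthsByHeight k = trans (VecP.lookup∘tabulate _ (π ⟨$⟩ˡ k)) (cong (w I) (inverseʳ π))

  count-F : count InF? ≡ sizeF I π
  count-F = sym (trans (countTrue≡count (Fbits I π)) (count-permute (set? (Fbits I π)) (flip π)))

  rejected-overflows : HeightOrder I π → ∀ r → ¬ InF I π r → W I < F-width (h I r ≤?_) + w I r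
  rejected-overflows height-order r r∉F = begin-strict
    W I                                        <⟨ greedy-rejects (W I) widthsByHeight 0ℚ p (¬-not r∉F) ⟩
    0ℚ + sumOver Earlier? ws + lookup widthsByHeight p
                                               ≡⟨ cong₂ _+_ (ℚP.+-identityˡ (sumOver Earlier? ws))
                                                            (lookup-widthsByHeight r) ⟩
    sumOver Earlier? ws + w I r                ≡⟨ cong (_+ w I r) (sumOver-permute Earlier? ws (flip π)) ⟩
    sumOver (Earlier? ∘ (π ⟨$⟩ˡ_)) (ws ∘ (π ⟨$⟩ˡ_)) + w I r
                                               ≤⟨ ℚP.+-monoˡ-≤ (w I r) earlier⊆taller ⟩
    F-width (h I r ≤?_) + w I r                ∎
    where
    open ℚP.≤-Reasoning
    p  = π ⟨$⟩ˡ r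
    ws = lookup widthsByHeight

    Earlier? : Decidable (λ t → toℕ t ℕ.< toℕ p × lookup (Fbits I π) t ≡ true)
    Earlier? t = (toℕ t ℕ.<? toℕ p) ×-dec set? (Fbits I π) t

    earlier⊆taller : sumOver (Earlier? ∘ (π ⟨$⟩ˡ_)) (ws ∘ (π ⟨$⟩ˡ_)) ≤ F-width (h I r ≤?_)
    earlier⊆taller =
      sumOver-mono (Earlier? ∘ (π ⟨$⟩ˡ_)) (λ k → InF? k ×-dec (h I r ≤? h I k)) (w-nonneg I)
                   (ℚP.≤-reflexive ∘ lookup-widthsByHeight)
                   λ {k} (k<r , k∈F) →
                     k∈F , subst₂ (λ u v → h I u ≤ h I v) (inverseʳ π) (inverseʳ π)
                                  (height-order (π ⟨$⟩ˡ k) p (ℕP.<⇒≤ k<r))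

  module _ (fqw : IsFQWOrdering I π) where

    F-downwardClosed : DownwardClosed (InF I π)
    F-downwardClosed {j} {k} j<k k∈F with classify j
    ... | cF , j∈F = j∈F
    ... | cQ , j∈Q = contradiction (proj₁ (fqw j k j<k) cQ cF j∈Q k∈F) λ ()
    ... | cW , j∈W = contradiction (proj₁ (fqw j k j<k) cW cF j∈W k∈F) λ ()

    F-prefix : ∀ k → InF I π k ⇔ toℕ k ℕ.< sizeF I π
    F-prefix k = subst (λ a → InF I π k ⇔ toℕ k ℕ.< a) count-F
                       (downwardClosed⇒prefix F-downwardClosed InF? k)

    F-fits : prefixSum (w I) (sizeF I π) ≤ W I
    F-fits = begin
      prefixSum (w I) (sizeF I π)                         ≡⟨ sumOver-cong InF? (λ k → toℕ k ℕ.<? sizeF I π)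
                                                               (λ {k} → F-prefix k) lookup-widthsByHeight ⟨
      sumOver InF? (lookup widthsByHeight ∘ (π ⟨$⟩ˡ_))    ≡⟨ sumOver-permute (set? (Fbits I π))
                                                               (lookup widthsByHeight) (flip π) ⟨
      sumOver (set? (Fbits I π)) (lookup widthsByHeight)  ≡⟨ ℚP.+-identityˡ _ ⟨
      0ℚ + sumOver (set? (Fbits I π)) (lookup widthsByHeight)
                                                          ≤⟨ greedy-fits (W I) widthsByHeight 0ℚ (ℚP.<⇒≤ (W-pos I)) ⟩
      W I                                                 ∎
      where open ℚP.≤-Reasoning

    Q-after-F : ∀ {r} → InQ I π r → sizeF I π ℕ.≤ toℕ r
    Q-after-F {r} (r∉F , _) = ℕP.≮⇒≥ (r∉F ∘ Equivalence.from (F-prefix r))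

    module _ {i : Fin n} (i≡a : toℕ i ≡ sizeF I π) where

      Q-at-or-after-i : ∀ {r} → InQ I π r → r ≡ i ⊎ i <ᶠ r
      Q-at-or-after-i r∈Q with ℕP.m≤n⇒m<n∨m≡n (subst (ℕ._≤ _) (sym i≡a) (Q-after-F r∈Q))
      ... | inj₁ i<r = inj₂ i<r
      ... | inj₂ i≡r = inj₁ (FinP.toℕ-injective (sym i≡r))

      i∈Q : Σ (Fin n) (InQ I π) → InQ I π i
      i∈Q (q , q∈Q) with classify i
      ... | cF , i∈F = contradiction (Equivalence.to (F-prefix i) i∈F) (ℕP.<-irrefl i≡a)
      ... | cQ , i∈Q = i∈Q
      ... | cW , i∈W with Q-at-or-after-i q∈Q
      ...   | inj₁ refl = contradiction i∈W (proj₂ q∈Q)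
      ...   | inj₂ i<q  = contradiction (proj₁ (fqw i q i<q) cW cQ i∈W q∈Q) λ { (s≤s ()) }

      Q-narrower-than-i : Σ (Fin n) (InQ I π) → ∀ {r} → InQ I π r → w I r ≤ w I i
      Q-narrower-than-i Q≠∅ {r} r∈Q with Q-at-or-after-i r∈Q
      ... | inj₁ refl = ℚP.≤-refl
      ... | inj₂ i<r  = proj₂ (proj₂ (fqw i r i<r)) (i∈Q Q≠∅) r∈Q

module BottomLeft {n} (I : Instance n) (x y : Fin n → ℚ) (bl : IsBL I x y) where

  OnFloorRow : Fin n → Set
  OnFloorRow k = y k ≡ 0ℚ × x k ≡ prefixSum (w I) (toℕ k)

  right-of-row : ∀ {i px py} → Fits I x y i px py → ∀ u → u ℕ.≤ n →
                 (∀ j → toℕ j ℕ.< u → j <ᶠ i × OnFloorRow j × py < h I j) →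
                 prefixSum (w I) u ≤ px
  right-of-row {i} {px} {py} (px≥0 , _ , py≥0 , disjoint) u u≤n below =
    beyond-intervals (subst (_≤ px) (sym (prefixSum-zero (w I))) px≥0) u avoids
    where
    Avoids : ℕ → Set
    Avoids t = px < prefixSum (w I) t ⊎ prefixSum (w I) (suc t) ≤ px

    avoids-row : ∀ j → toℕ j ℕ.< u → Avoids (toℕ j)
    avoids-row j j<u with below j j<u
    ... | j<i , (yⱼ≡0 , xⱼ≡Sⱼ) , py<hⱼ with Disjoint⇒side-by-side (disjoint j j<i) py<yⱼ+hⱼ yⱼ<py+hᵢ
      where
      py<yⱼ+hⱼ : py < y j + h I j
      py<yⱼ+hⱼ = subst (py <_) (sym (trans (cong (_+ h I j) yⱼ≡0) (ℚP.+-identityˡ (h I j)))) py<hⱼ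
      yⱼ<py+hᵢ : y j < py + h I i
      yⱼ<py+hᵢ = subst (_< py + h I i) (sym yⱼ≡0) (ℚP.≤-<-trans py≥0 (p<p+q py (h-pos I i)))
    ... | inj₁ left  = inj₁ (ℚP.<-≤-trans (p<p+q px (w-pos I i)) (subst (px + w I i ≤_) xⱼ≡Sⱼ left))
    ... | inj₂ right = inj₂ (subst (_≤ px) (trans (cong (_+ w I j) xⱼ≡Sⱼ) (sym (prefixSum-suc (w I) j)))
                                   right)

    avoids : ∀ t → t ℕ.< u → Avoids t
    avoids t t<u = subst Avoids (FinP.toℕ-fromℕ< t<n)
                     (avoids-row (fromℕ< t<n) (subst (ℕ._< u) (sym (FinP.toℕ-fromℕ< t<n)) t<u))
      where t<n = ℕP.<-≤-trans t<u u≤n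

  next-in-row : ∀ {a} → prefixSum (w I) a ≤ W I → ∀ k → toℕ k ℕ.< a →
                (∀ j → j <ᶠ k → OnFloorRow j) → OnFloorRow k
  next-in-row {a} row-fits k k<a row with bl k
  ... | fits@(_ , _ , yₖ≥0 , _) , bottom-left with bottom-left (prefixSum (w I) (toℕ k)) 0ℚ next-slot
    where
    next-slot : Fits I x y k (prefixSum (w I) (toℕ k)) 0ℚ
    next-slot = prefixSum-nonneg (w-nonneg I) (toℕ k)
              , subst (_≤ W I) (prefixSum-suc (w I) k)
                      (ℚP.≤-trans (prefixSum-mono (w-nonneg I) k<a) row-fits)
              , ℚP.≤-refl
              , λ j j<k → inj₂ (inj₁ (subst (_≤ prefixSum (w I) (toℕ k))
                              (trans (prefixSum-suc (w I) j) (cong (_+ w I j) (sym (proj₂ (row j j<k)))))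
                              (prefixSum-mono (w-nonneg I) j<k)))
  ... | inj₁ yₖ<0 = contradiction yₖ≥0 (<⇒≱ yₖ<0)
  ... | inj₂ (yₖ≡0 , xₖ≤Sₖ) =
    yₖ≡0 , ℚP.≤-antisym xₖ≤Sₖ (right-of-row fits (toℕ k) (ℕP.<⇒≤ (FinP.toℕ<n k))
                                 λ j j<k → j<k , row j j<k , subst (_< h I j) (sym yₖ≡0) (h-pos I j))

  floor-row : ∀ {a} → prefixSum (w I) a ≤ W I → ∀ k → toℕ k ℕ.< a → OnFloorRow k
  floor-row {a} row-fits k = go k (<-wellFounded k)
    where
    go : ∀ k → Acc _<ᶠ_ k → toℕ k ℕ.< a → OnFloorRow k
    go k (acc earlier) k<a = next-in-row row-fits k k<a λ j j<k → go j (earlier j<k) (ℕP.<-trans j<k k<a)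

module FQWBottomLeft {n} (I : Instance n) (π : Permutation′ n) (fqw : IsFQWOrdering I π)
                     (x y : Fin n → ℚ) (bl : IsBL I x y) where
  open FQWPartition I π
  open BottomLeft I x y bl

  F-on-floor : ∀ k → InF I π k → OnFloorRow k
  F-on-floor k k∈F = floor-row (F-fits fqw) k (Equivalence.to (F-prefix fqw k) k∈F)

  taller-F-left-of : ∀ {i px py} → sizeF I π ℕ.≤ toℕ i → Fits I x y i px py → F-width (py <?_) ≤ px
  taller-F-left-of {i} {px} {py} a≤i fits = begin
    sumOver Taller? (w I)            ≡⟨ sumOver-cong Taller? (λ k → toℕ k ℕ.<? count Taller?)
                                          (λ {k} → prefix k) (λ _ → refl) ⟩
    prefixSum (w I) (count Taller?)  ≤⟨ right-of-row fits (count Taller?) (count-≤ Taller?) below ⟩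
    px                               ∎
    where
    open ℚP.≤-Reasoning
    Taller? : Decidable (λ k → InF I π k × py < h I k)
    Taller? k = InF? k ×-dec (py <? h I k)

    closed : DownwardClosed (λ k → InF I π k × py < h I k)
    closed {j} {k} j<k (k∈F , py<hₖ) = j∈F , ℚP.<-≤-trans py<hₖ (proj₁ (proj₂ (fqw j k j<k)) j∈F k∈F)
      where j∈F = F-downwardClosed fqw j<k k∈F

    prefix : ∀ k → (InF I π k × py < h I k) ⇔ toℕ k ℕ.< count Taller?
    prefix = downwardClosed⇒prefix closed Taller?

    below : ∀ j → toℕ j ℕ.< count Taller? → j <ᶠ i × OnFloorRow j × py < h I j
    below j j<u with Equivalence.from (prefix j) j<u
    ... | j∈F , py<hⱼ =
      ℕP.<-≤-trans (Equivalence.to (F-prefix fqw j) j∈F) a≤i , F-on-floor j j∈F , py<hⱼ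

lemma9 : ∀ {n} (I : Instance n) (π : Permutation′ n)
           → HeightOrder I π → IsFQWOrdering I π
           → (x y : Fin n → ℚ) → IsBL I x y
           → Σ (Fin n) (λ q → InQ I π q)
           → Σ (Fin n) (λ q → InQ I π q × hmax I < y q + h I q)
           → (i : Fin n) → toℕ i ≡ sizeF I π
           → (B : Fin n) → LeftmostBottomSupporter I x y i B
           → ∀ r → InQ I π r → h I r ≤ h I B
lemma9 I π height-order fqw x y bl Q≠∅ _ i i≡a B ((_ , B<i , yB+hB≡yᵢ , _) , _) r r∈Q =
  subst (h I r ≤_) (sym hB≡yᵢ) (ℚP.≮⇒≥ yᵢ≮hᵣ)
  where
  open FQWPartition I π
  open FQWBottomLeft I π fqw x y bl

  hB≡yᵢ : h I B ≡ y i
  hB≡yᵢ = begin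
    h I B        ≡⟨ ℚP.+-identityˡ (h I B) ⟨
    0ℚ + h I B   ≡⟨ cong (_+ h I B) (proj₁ (F-on-floor B B∈F)) ⟨
    y B + h I B  ≡⟨ yB+hB≡yᵢ ⟩
    y i          ∎
    where
    open ≡-Reasoning
    B∈F = Equivalence.from (F-prefix fqw B) (subst (toℕ B ℕ.<_) i≡a B<i)

  yᵢ≮hᵣ : ¬ (y i < h I r)
  yᵢ≮hᵣ yᵢ<hᵣ = <⇒≱ overflow (proj₁ (proj₂ (proj₁ (bl i))))
    where
    open ℚP.≤-Reasoning
    overflow : W I < x i + w I i
    overflow = begin-strict
      W I                          <⟨ rejected-overflows height-order r (proj₁ r∈Q) ⟩
      F-width (h I r ≤?_) + w I r  ≤⟨ ℚP.+-mono-≤ (F-width-mono (h I r ≤?_) (y i <?_) (ℚP.<-≤-trans yᵢ<hᵣ))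
                                                  (Q-narrower-than-i fqw i≡a Q≠∅ r∈Q) ⟩
      F-width (y i <?_) + w I i    ≤⟨ ℚP.+-monoˡ-≤ (w I i)
                                        (taller-F-left-of (ℕP.≤-reflexive (sym i≡a)) (proj₁ (bl i))) ⟩
      x i + w I i                  ∎
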